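{- Let $G_1,\dots,G_n$ ($n\ge2$) be games each of which is both miserable and forced. Then their disjunctive sum $G_1+\dots+G_n$ is forced.
   Context: A game is a two-player impartial game given by a directed acyclic graph whose vertices are positions and whose arcs are moves, such that from every position only finitely many positions are reachable. A position with no moves is terminal. $\operatorname{mex}(S)$ is the least non-negative integer not in $S$. The normal Sprague–Grundy function is $\mathcal{G}(x)=\operatorname{mex}\{\mathcal{G}(y): x\to y\}$ (so $0$ on terminal positions); the misère Sprague–Grundy function $\mathcal{G}^-$ satisfies $\mathcal{G}^-(x)=1$ for terminal $x$ and $\mathcal{G}^-(x)=\operatorname{mex}\{\mathcal{G}^-(y): x\to y\}$ otherwise. An $(i,j)$-position is a position $x$ with $\mathcal{G}(x)=i$, $\mathcal{G}^-(x)=j$, and $V_{i,j}$ the set of them. A position $x$ is movable to a set $W$ if there is a move from $x$ to some position of $W$. A game is miserable if every position $x$ satisfies at least one of: (a) $x\in V_{0,1}\cup V_{1,0}$; (b) $x$ is not movable to $V_{0,1}\cup V_{1,0}$; (c) $x$ is movable to $V_{0,1}$ and to $V_{1,0}$. A game is forced if every move from a $(0,1)$-position leads to a $(1,0)$-position and every move from a $(1,0)$-position leads to a $(0,1)$-position. The disjunctive sum has positions $(x_1,\dots,x_n)$, $x_i$ a position of $G_i$, and a move consists of making a move in exactly one coordinate; $\mathcal{G},\mathcal{G}^-$ of the sum are computed in the sum itself. -}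

module Defs where

open import Data.Nat using (ℕ; zero; suc; _+_; _<_; _≤_; _≟_)
open import Data.Nat.Properties using (+-mono-<-≤; +-monoʳ-<; ≤-refl; ≤-reflexive)
open import Data.Fin using (Fin) renaming (zero to fzero; suc to fsuc; _≟_ to _≟ᶠ_)
open import Data.Fin.Properties using (suc-injective)
open import Data.List using (List; []; _∷_; map; length; concatMap; allFin)
open import Data.List.Relation.Unary.Any using (Any)
open import Data.List.Membership.Propositional using (_∈_)
open import Data.List.Membership.Propositional.Properties using (∈-concatMap⁻; ∈-map⁻)
open import Data.List.Membership.DecPropositional _≟_ using (_∈?_)
open import Data.Product using (Σ; _×_; _,_; ∃)
open import Data.Sum using (_⊎_)
open import Relation.Nullary using (¬_; yes; no)
open import Relation.Binary.PropositionalEquality using (_≡_; refl; sym; cong)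
open import Function using (_∘_)

-- mex of a finite list of naturals: least n not in the list.
-- (The mex of a list l is at most length l, so searching the
-- length l + 1 candidates 0 .. length l suffices.)

mexFrom : List ℕ → (fuel start : ℕ) → ℕ
mexFrom l zero      n = n
mexFrom l (suc k) n with n ∈? l
... | yes _ = mexFrom l k (suc n)
... | no  _ = n

mex : List ℕ → ℕ
mex l = mexFrom l (suc (length l)) 0

-- Positions form a type, the moves from a position form a
-- finite list, and there is a rank function strictly decreasing along
-- moves (this is exactly "acyclic with finitely many positions
-- reachable from every position": take rank = length of longest play).

record Game : Set₁ where
  field
    Pos      : Set
    moves    : Pos → List Pos
    rank     : Pos → ℕ
    rank-dec : ∀ {x y} → y ∈ moves x → rank y < rank x
open Game public

Move : (G : Game) → Pos G → Pos G → Set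
Move G x y = y ∈ moves G x

-- Sprague–Grundy functions, by recursion on a fuel parameter; the fuel
-- 1 + rank x is always sufficient (rank strictly decreases along moves).

grundyF : (G : Game) → ℕ → Pos G → ℕ
grundyF G zero    x = 0
grundyF G (suc k) x = mex (map (grundyF G k) (moves G x))

grundy : (G : Game) → Pos G → ℕ
grundy G x = grundyF G (suc (rank G x)) x

misMex : List ℕ → ℕ
misMex []       = 1
misMex (a ∷ as) = mex (a ∷ as)

grundy⁻F : (G : Game) → ℕ → Pos G → ℕ
grundy⁻F G zero    x = 0
grundy⁻F G (suc k) x = misMex (map (grundy⁻F G k) (moves G x))

grundy⁻ : (G : Game) → Pos G → ℕ
grundy⁻ G x = grundy⁻F G (suc (rank G x)) x

V : (G : Game) → ℕ → ℕ → Pos G → Set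
V G i j x = (grundy G x ≡ i) × (grundy⁻ G x ≡ j)

MovableTo : (G : Game) → Pos G → (Pos G → Set) → Set
MovableTo G x W = ∃ λ y → Move G x y × W y

Miserable : Game → Set
Miserable G = ∀ (x : Pos G) →
    (V G 0 1 x ⊎ V G 1 0 x)
  ⊎ (¬ MovableTo G x (λ y → V G 0 1 y ⊎ V G 1 0 y))
  ⊎ (MovableTo G x (V G 0 1) × MovableTo G x (V G 1 0))

Forced : Game → Set
Forced G = ∀ (x y : Pos G) → Move G x y →
  (V G 0 1 x → V G 1 0 y) × (V G 1 0 x → V G 0 1 y)

update : ∀ {n} {P : Fin n → Set} → ((j : Fin n) → P j) → (i : Fin n) → P i → (j : Fin n) → P j
update x i y j with i ≟ᶠ j
... | yes refl = y
... | no  _    = x j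

update-same : ∀ {n} {P : Fin n → Set} (x : (j : Fin n) → P j) i y → update {P = P} x i y i ≡ y
update-same x i y with i ≟ᶠ i
... | yes refl = refl
... | no  i≢i  = Relation.Nullary.contradiction refl i≢i
  where import Relation.Nullary

update-other : ∀ {n} {P : Fin n → Set} (x : (j : Fin n) → P j) i y j → ¬ (i ≡ j) → update {P = P} x i y j ≡ x j
update-other x i y j i≢j with i ≟ᶠ j
... | yes refl = Relation.Nullary.contradiction refl i≢j
  where import Relation.Nullary
... | no  _    = refl

∑ : ∀ {n} → (Fin n → ℕ) → ℕ
∑ {zero}  f = 0
∑ {suc n} f = f fzero + ∑ (f ∘ fsuc)

∑-eq : ∀ {n} (f g : Fin n → ℕ) → (∀ j → g j ≡ f j) → ∑ g ≡ ∑ f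
∑-eq {zero}  f g e = refl
∑-eq {suc n} f g e rewrite e fzero | ∑-eq (f ∘ fsuc) (g ∘ fsuc) (e ∘ fsuc) = refl

∑-dec : ∀ {n} (f g : Fin n → ℕ) (i : Fin n) → g i < f i →
        (∀ j → ¬ (i ≡ j) → g j ≡ f j) → ∑ g < ∑ f
∑-dec {suc n} f g fzero lt e =
  +-mono-<-≤ lt (≤-reflexive (∑-eq (f ∘ fsuc) (g ∘ fsuc) (λ j → e (fsuc j) (λ ()))))
∑-dec {suc n} f g (fsuc i) lt e rewrite e fzero (λ ()) =
  +-monoʳ-< (f fzero) (∑-dec (f ∘ fsuc) (g ∘ fsuc) i lt (λ j i≢j → e (fsuc j) (λ p → i≢j (suc-injective p))))

module _ (n : ℕ) (Gs : Fin n → Game) where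

  SumPos : Set
  SumPos = (i : Fin n) → Pos (Gs i)

  sumMoves : SumPos → List SumPos
  sumMoves x = concatMap (λ i → map (update {P = Pos ∘ Gs} x i) (moves (Gs i) (x i))) (allFin n)

  sumRank : SumPos → ℕ
  sumRank x = ∑ (λ j → rank (Gs j) (x j))

  sumRank-dec : ∀ {x y} → y ∈ sumMoves x → sumRank y < sumRank x
  sumRank-dec {x} {y} y∈ = go (∈-concatMap⁻ (λ i → map (update {P = Pos ∘ Gs} x i) (moves (Gs i) (x i))) {xs = allFin n} y∈)
    where
    go : ∀ {is} → Any (λ i → y ∈ map (update {P = Pos ∘ Gs} x i) (moves (Gs i) (x i))) is → sumRank y < sumRank x
    go (Any.there p) = go p
    go (Any.here {i} p) with ∈-map⁻ (update {P = Pos ∘ Gs} x i) p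
    ... | z , z∈ , refl =
      ∑-dec (λ j → rank (Gs j) (x j)) (λ j → rank (Gs j) (update {P = Pos ∘ Gs} x i z j)) i
        (Relation.Binary.PropositionalEquality.subst (λ w → rank (Gs i) w < rank (Gs i) (x i))
           (sym (update-same {P = Pos ∘ Gs} x i z)) (rank-dec (Gs i) z∈))
        (λ j i≢j → cong (rank (Gs j)) (update-other {P = Pos ∘ Gs} x i z j i≢j))
      where import Relation.Binary.PropositionalEquality

SumGame : (n : ℕ) → (Fin n → Game) → Game
SumGame n Gs = record
  { Pos      = SumPos n Gs
  ; moves    = sumMoves n Gs
  ; rank     = sumRank n Gs
  ; rank-dec = sumRank-dec n Gs
  }

-- Call a position of a component game balanced if it lies in V₀₁ ∪ V₁₀; in a forced game
-- every move from a balanced position swaps V₀₁ and V₁₀.  A position of the sum all of whose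
-- components are balanced therefore behaves like a game of parity: by induction it lies in
-- V₀₁ when an even number of its components are in V₁₀ and in V₁₀ otherwise.  If some
-- component is unbalanced, the only way to reach an all-balanced position is to move in that
-- component to V₀₁ ∪ V₁₀; by miserability that component can then also be moved into both
-- V₀₁ and V₁₀, which gives options of the sum in both V₀₁ and V₁₀.  Hence both Grundy
-- functions see the same set of option values and 𝒢 = 𝒢⁻ there.  So a position of the sum in
-- V₀₁ ∪ V₁₀ is all-balanced, and the parity argument shows that every move swaps the two sets.
module Submission where

open import Defs
open import Data.Nat using (ℕ; zero; suc; _≤_; _<_; _≟_; s≤s)
open import Data.Nat.Properties using (<-≤-trans; n<1+n)
open import Data.Nat.Induction using (<-wellFounded)
open import Induction.WellFounded using (Acc; acc)
open import Data.Fin using (Fin) renaming (zero to fzero; suc to fsuc; _≟_ to _≟ᶠ_)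
open import Data.Fin.Properties using (¬∀⟶∃¬; all?; suc-injective)
open import Data.Bool using (Bool; true; false; not; _xor_)
open import Data.Bool.Properties using (not-distribˡ-xor; not-distribʳ-xor)
open import Data.List using (List; []; _∷_; map; length; allFin)
open import Data.List.Properties using (length-map; map-cong-local)
import Data.List.Relation.Unary.All as All
open import Data.List.Relation.Unary.Any using (here; satisfied)
open import Data.List.Relation.Unary.Any.Properties using (¬Any[])
open import Data.List.Relation.Binary.Subset.Propositional using (_⊆_)
open import Data.List.Membership.Propositional using (_∈_; _∉_; lose)
open import Data.List.Membership.Propositional.Properties
  using (∈-concatMap⁻; ∈-concatMap⁺; ∈-map⁻; ∈-map⁺; ∈-allFin)
open import Data.List.Membership.DecPropositional _≟_ using (_∈?_)
open import Data.Product using (_×_; _,_; ∃; ∃-syntax; ∃₂; proj₁; proj₂; map₂)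
open import Data.Sum using (_⊎_; inj₁; inj₂)
open import Data.Empty using (⊥-elim)
open import Relation.Nullary using (¬_; yes; no; Dec; does; contradiction)
open import Relation.Nullary.Decidable using (_×-dec_; _⊎-dec_)
open import Relation.Binary.PropositionalEquality
  using (_≡_; _≢_; refl; sym; trans; cong; cong₂; subst; module ≡-Reasoning)
open import Function using (_∘_)

open ≡-Reasoning

mex≡0 : ∀ {l} → 0 ∉ l → mex l ≡ 0
mex≡0 {l} 0∉l with 0 ∈? l
... | yes 0∈l = contradiction 0∈l 0∉l
... | no _    = refl

mex≡1 : ∀ {l} → 0 ∈ l → 1 ∉ l → mex l ≡ 1
mex≡1 {l@(_ ∷ _)} 0∈l 1∉l with 0 ∈? l
... | no 0∉l = contradiction 0∈l 0∉l
... | yes _ with 1 ∈? l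
...   | yes 1∈l = contradiction 1∈l 1∉l
...   | no _    = refl

mexFrom-cong : ∀ {l l'} → l ⊆ l' → l' ⊆ l → ∀ fuel m → mexFrom l fuel m ≡ mexFrom l' fuel m
mexFrom-cong         l⊆l' l'⊆l zero       m = refl
mexFrom-cong {l} {l'} l⊆l' l'⊆l (suc fuel) m with m ∈? l | m ∈? l'
... | yes _   | yes _    = mexFrom-cong l⊆l' l'⊆l fuel (suc m)
... | no _    | no _     = refl
... | yes m∈l | no m∉l'  = contradiction (l⊆l' m∈l) m∉l'
... | no m∉l  | yes m∈l' = contradiction (l'⊆l m∈l') m∉l

-- The fuel of mex is computed from the length of the list, hence the length hypothesis.
mex-cong : ∀ {l l'} → length l ≡ length l' → l ⊆ l' → l' ⊆ l → mex l ≡ mex l'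
mex-cong {l' = l'} eq l⊆l' l'⊆l rewrite eq = mexFrom-cong l⊆l' l'⊆l (suc (length l')) 0

misMex-nonempty : ∀ {a l} → a ∈ l → misMex l ≡ mex l
misMex-nonempty {l = _ ∷ _} _ = refl

misMex≡1 : ∀ {l} → (∀ {a} → a ∈ l → a ≡ 0) → misMex l ≡ 1
misMex≡1 {[]}         all0 = refl
misMex≡1 {l@(_ ∷ _)} all0 =
  mex≡1 (subst (_∈ l) (all0 (here refl)) (here refl)) (λ 1∈l → contradiction (all0 1∈l) λ ())

map-⊆ : ∀ {A : Set} {f g : A → ℕ} {xs : List A} →
        (∀ {x} → x ∈ xs → ∃[ x' ] x' ∈ xs × f x ≡ g x') → map f xs ⊆ map g xs
map-⊆ {f = f} {g} partner a∈ with ∈-map⁻ f a∈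
... | x , x∈ , refl with partner x∈
...   | x' , x'∈ , fx≡gx' = subst (_∈ _) (sym fx≡gx') (∈-map⁺ g x'∈)

game-ind : (G : Game) (P : Pos G → Set) →
           (∀ x → (∀ {y} → Move G x y → P y) → P x) → ∀ x → P x
game-ind G P step x = go x (<-wellFounded (rank G x))
  where
  go : ∀ x → Acc _<_ (rank G x) → P x
  go x (acc rs) = step x λ y∈ → go _ (rs (rank-dec G y∈))

module FuelledRecursion (G : Game) (rule : List ℕ → ℕ) (F : ℕ → Pos G → ℕ)
                        (F-suc : ∀ k x → F (suc k) x ≡ rule (map (F k) (moves G x))) where

  fuel-irrelevant : ∀ {k k'} x → rank G x < k → rank G x < k' → F k x ≡ F k' x
  fuel-irrelevant {suc k} {suc k'} x (s≤s r≤k) (s≤s r≤k') = begin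
    F (suc k) x                    ≡⟨ F-suc k x ⟩
    rule (map (F k) (moves G x))   ≡⟨ cong rule (map-cong-local (All.tabulate λ y∈ →
                                        fuel-irrelevant _ (<-≤-trans (rank-dec G y∈) r≤k)
                                                          (<-≤-trans (rank-dec G y∈) r≤k'))) ⟩
    rule (map (F k') (moves G x))  ≡⟨ F-suc k' x ⟨
    F (suc k') x                   ∎

  unfold : ∀ x → F (suc (rank G x)) x ≡ rule (map (λ y → F (suc (rank G y)) y) (moves G x))
  unfold x = trans (F-suc (rank G x) x) (cong rule (map-cong-local (All.tabulate λ y∈ →
    fuel-irrelevant _ (rank-dec G y∈) (n<1+n _))))

module _ (G : Game) where

  grundy-unfold : ∀ x → grundy G x ≡ mex (map (grundy G) (moves G x))
  grundy-unfold = FuelledRecursion.unfold G mex (grundyF G) (λ _ _ → refl)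

  grundy⁻-unfold : ∀ x → grundy⁻ G x ≡ misMex (map (grundy⁻ G) (moves G x))
  grundy⁻-unfold = FuelledRecursion.unfold G misMex (grundy⁻F G) (λ _ _ → refl)

  grundy≡0 : ∀ {x} → (∀ {y} → Move G x y → grundy G y ≢ 0) → grundy G x ≡ 0
  grundy≡0 {x} h = trans (grundy-unfold x) (mex≡0 λ 0∈ →
    let y , y∈ , 0≡gy = ∈-map⁻ (grundy G) 0∈ in h y∈ (sym 0≡gy))

  grundy≡1 : ∀ {x y} → Move G x y → grundy G y ≡ 0 →
             (∀ {y} → Move G x y → grundy G y ≢ 1) → grundy G x ≡ 1
  grundy≡1 {x} y∈ gy≡0 h = trans (grundy-unfold x)
    (mex≡1 (subst (_∈ _) gy≡0 (∈-map⁺ (grundy G) y∈))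
           (λ 1∈ → let y , y∈ , 1≡gy = ∈-map⁻ (grundy G) 1∈ in h y∈ (sym 1≡gy)))

  grundy⁻≡1 : ∀ {x} → (∀ {y} → Move G x y → grundy⁻ G y ≡ 0) → grundy⁻ G x ≡ 1
  grundy⁻≡1 {x} h = trans (grundy⁻-unfold x) (misMex≡1 λ a∈ →
    let y , y∈ , a≡g⁻y = ∈-map⁻ (grundy⁻ G) a∈ in trans a≡g⁻y (h y∈))

  grundy⁻≡0 : ∀ {x y} → Move G x y → (∀ {y} → Move G x y → grundy⁻ G y ≢ 0) → grundy⁻ G x ≡ 0
  grundy⁻≡0 {x} y∈ h = begin
    grundy⁻ G x                           ≡⟨ grundy⁻-unfold x ⟩
    misMex (map (grundy⁻ G) (moves G x))  ≡⟨ misMex-nonempty (∈-map⁺ (grundy⁻ G) y∈) ⟩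
    mex (map (grundy⁻ G) (moves G x))     ≡⟨ mex≡0 (λ 0∈ →
      let y , y∈ , 0≡g⁻y = ∈-map⁻ (grundy⁻ G) 0∈ in h y∈ (sym 0≡g⁻y)) ⟩
    0                                     ∎

  V₀₁⊎movable : ∀ x → V G 0 1 x ⊎ ∃ (Move G x)
  V₀₁⊎movable x = by-cases (moves G x) refl
    where
    by-cases : ∀ ms → moves G x ≡ ms → V G 0 1 x ⊎ ∃ (Move G x)
    by-cases []      eq = inj₁ (grundy≡0 (⊥-elim ∘ terminal) , grundy⁻≡1 (⊥-elim ∘ terminal))
      where
      terminal : ∀ {y} → ¬ Move G x y
      terminal y∈ = ¬Any[] (subst (_ ∈_) eq y∈)
    by-cases (y ∷ _) eq = inj₂ (y , subst (y ∈_) (sym eq) (here refl))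

  V₁₀⇒movable : ∀ {x} → V G 1 0 x → ∃ (Move G x)
  V₁₀⇒movable {x} (_ , g⁻x≡0) with V₀₁⊎movable x
  ... | inj₁ (_ , g⁻x≡1) = contradiction (trans (sym g⁻x≡0) g⁻x≡1) λ ()
  ... | inj₂ movable     = movable

  -- The partners make the sets of option values under 𝒢 and under 𝒢⁻ equal.
  grundy≡grundy⁻ : ∀ {x} → ∃ (Move G x) →
    (∀ {y} → Move G x y → ∃[ y' ] Move G x y' × grundy G y ≡ grundy⁻ G y' × grundy⁻ G y ≡ grundy G y') →
    grundy G x ≡ grundy⁻ G x
  grundy≡grundy⁻ {x} (y , y∈) partner = begin
    grundy G x                            ≡⟨ grundy-unfold x ⟩
    mex (map (grundy G) (moves G x))      ≡⟨ mex-cong same-length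
                                               (map-⊆ λ y∈ → let y' , y'∈ , e , _ = partner y∈ in y' , y'∈ , e)
                                               (map-⊆ λ y∈ → let y' , y'∈ , _ , e = partner y∈ in y' , y'∈ , e) ⟩
    mex (map (grundy⁻ G) (moves G x))     ≡⟨ misMex-nonempty (∈-map⁺ (grundy⁻ G) y∈) ⟨
    misMex (map (grundy⁻ G) (moves G x))  ≡⟨ grundy⁻-unfold x ⟨
    grundy⁻ G x                           ∎
    where
    same-length : length (map (grundy G) (moves G x)) ≡ length (map (grundy⁻ G) (moves G x))
    same-length = trans (length-map (grundy G) (moves G x)) (sym (length-map (grundy⁻ G) (moves G x)))

-- A data type rather than a function of the Boolean, so that the index can be inferred.

data Vᵇ (G : Game) : Bool → Pos G → Set where
  in₀₁ : ∀ {x} → V G 0 1 x → Vᵇ G false x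
  in₁₀ : ∀ {x} → V G 1 0 x → Vᵇ G true x

Balanced : (G : Game) → Pos G → Set
Balanced G x = V G 0 1 x ⊎ V G 1 0 x

balanced? : (G : Game) → ∀ x → Dec (Balanced G x)
balanced? G x = ((grundy G x ≟ 0) ×-dec (grundy⁻ G x ≟ 1)) ⊎-dec ((grundy G x ≟ 1) ×-dec (grundy⁻ G x ≟ 0))

class : (G : Game) → Pos G → Bool
class G x = does (grundy G x ≟ 1)

module _ {G : Game} where

  out₀₁ : ∀ {x} → Vᵇ G false x → V G 0 1 x
  out₀₁ (in₀₁ v) = v

  out₁₀ : ∀ {x} → Vᵇ G true x → V G 1 0 x
  out₁₀ (in₁₀ v) = v

  Vᵇ⇒balanced : ∀ {b x} → Vᵇ G b x → Balanced G x
  Vᵇ⇒balanced (in₀₁ v) = inj₁ v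
  Vᵇ⇒balanced (in₁₀ v) = inj₂ v

  balanced⇒Vᵇ-class : ∀ {x} → Balanced G x → Vᵇ G (class G x) x
  balanced⇒Vᵇ-class (inj₁ v@(gx≡0 , _)) rewrite gx≡0 = in₀₁ v
  balanced⇒Vᵇ-class (inj₂ v@(gx≡1 , _)) rewrite gx≡1 = in₁₀ v

  Vᵇ⇒class≡ : ∀ {b x} → Vᵇ G b x → class G x ≡ b
  Vᵇ⇒class≡ (in₀₁ (gx≡0 , _)) rewrite gx≡0 = refl
  Vᵇ⇒class≡ (in₁₀ (gx≡1 , _)) rewrite gx≡1 = refl

  Vᵇ-unique : ∀ {b b' x} → Vᵇ G b x → Vᵇ G b' x → b ≡ b'
  Vᵇ-unique x∈b x∈b' = trans (sym (Vᵇ⇒class≡ x∈b)) (Vᵇ⇒class≡ x∈b')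

  Vᵇ⇒grundy≢grundy⁻ : ∀ {b x} → Vᵇ G b x → grundy G x ≢ grundy⁻ G x
  Vᵇ⇒grundy≢grundy⁻ (in₀₁ (gx≡0 , g⁻x≡1)) e = contradiction (trans (sym gx≡0) (trans e g⁻x≡1)) λ ()
  Vᵇ⇒grundy≢grundy⁻ (in₁₀ (gx≡1 , g⁻x≡0)) e = contradiction (trans (sym gx≡1) (trans e g⁻x≡0)) λ ()

  Vᵇ-swap : ∀ {b y y'} → Vᵇ G b y → Vᵇ G (not b) y' →
            grundy G y ≡ grundy⁻ G y' × grundy⁻ G y ≡ grundy G y'
  Vᵇ-swap (in₀₁ (gy≡0 , g⁻y≡1)) (in₁₀ (gy'≡1 , g⁻y'≡0)) = trans gy≡0 (sym g⁻y'≡0) , trans g⁻y≡1 (sym gy'≡1)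
  Vᵇ-swap (in₁₀ (gy≡1 , g⁻y≡0)) (in₀₁ (gy'≡0 , g⁻y'≡1)) = trans gy≡1 (sym g⁻y'≡1) , trans g⁻y≡0 (sym gy'≡0)

  Vᵇ-forced : Forced G → ∀ {b x y} → Move G x y → Vᵇ G b x → Vᵇ G (not b) y
  Vᵇ-forced forced y∈ (in₀₁ v) = in₁₀ (proj₁ (forced _ _ y∈) v)
  Vᵇ-forced forced y∈ (in₁₀ v) = in₀₁ (proj₂ (forced _ _ y∈) v)

  Vᵇ-by-options : ∀ b {x} → (∀ {y} → Move G x y → Vᵇ G (not b) y) → (b ≡ true → ∃ (Move G x)) → Vᵇ G b x
  Vᵇ-by-options false options _ = in₀₁
    ( grundy≡0 G (λ y∈ gy≡0 → contradiction (trans (sym gy≡0) (proj₁ (out₁₀ (options y∈)))) λ ())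
    , grundy⁻≡1 G (proj₂ ∘ out₁₀ ∘ options))
  Vᵇ-by-options true options movable with movable refl
  ... | _ , y∈ = in₁₀
    ( grundy≡1 G y∈ (proj₁ (out₀₁ (options y∈)))
        (λ y∈ gy≡1 → contradiction (trans (sym gy≡1) (proj₁ (out₀₁ (options y∈)))) λ ())
    , grundy⁻≡0 G y∈ (λ y∈ g⁻y≡0 → contradiction (trans (sym g⁻y≡0) (proj₂ (out₀₁ (options y∈)))) λ ()))

not-cover : ∀ {P : Bool → Set} c → P c → P (not c) → ∀ b → P b
not-cover false p q false = p
not-cover false p q true  = q
not-cover true  p q false = q
not-cover true  p q true  = p

parity : ∀ {m} → (Fin m → Bool) → Bool
parity {zero}  b = false
parity {suc m} b = b fzero xor parity (b ∘ fsuc)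

parity-cong : ∀ {m} {b c : Fin m → Bool} → (∀ j → b j ≡ c j) → parity b ≡ parity c
parity-cong {zero}  e = refl
parity-cong {suc m} e = cong₂ _xor_ (e fzero) (parity-cong (e ∘ fsuc))

parity-flip : ∀ {m} (b b' : Fin m → Bool) i → b' i ≡ not (b i) → (∀ j → i ≢ j → b' j ≡ b j) →
              parity b' ≡ not (parity b)
parity-flip {suc m} b b' fzero flipped same = begin
  b' fzero xor parity (b' ∘ fsuc)      ≡⟨ cong₂ _xor_ flipped (parity-cong λ j → same (fsuc j) λ ()) ⟩
  not (b fzero) xor parity (b ∘ fsuc)  ≡⟨ not-distribˡ-xor (b fzero) _ ⟨
  not (parity b)                       ∎
parity-flip {suc m} b b' (fsuc i) flipped same = begin
  b' fzero xor parity (b' ∘ fsuc)      ≡⟨ cong₂ _xor_ (same fzero λ ())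
                                            (parity-flip (b ∘ fsuc) (b' ∘ fsuc) i flipped
                                              λ j i≢j → same (fsuc j) (i≢j ∘ suc-injective)) ⟩
  b fzero xor not (parity (b ∘ fsuc))  ≡⟨ not-distribʳ-xor (b fzero) _ ⟨
  not (parity b)                       ∎

parity≡true⇒∃ : ∀ {m} (b : Fin m → Bool) → parity b ≡ true → ∃ λ i → b i ≡ true
parity≡true⇒∃ {suc m} b odd with b fzero in eq
... | true  = fzero , eq
... | false = let i , bi≡true = parity≡true⇒∃ (b ∘ fsuc) odd in fsuc i , bi≡true

module SumMoves (n : ℕ) (Gs : Fin n → Game) where

  infixl 6 _[_]≔_
  _[_]≔_ : SumPos n Gs → (i : Fin n) → Pos (Gs i) → SumPos n Gs
  x [ i ]≔ z = update {P = Pos ∘ Gs} x i z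

  []≔-same : ∀ x i z → (x [ i ]≔ z) i ≡ z
  []≔-same = update-same

  []≔-other : ∀ x i z j → i ≢ j → (x [ i ]≔ z) j ≡ x j
  []≔-other = update-other

  sumMove⁺ : ∀ {x} i {z} → Move (Gs i) (x i) z → Move (SumGame n Gs) x (x [ i ]≔ z)
  sumMove⁺ {x} i z∈ = ∈-concatMap⁺ (λ i → map (x [ i ]≔_) (moves (Gs i) (x i))) {xs = allFin n}
    (lose (∈-allFin i) (∈-map⁺ (x [ i ]≔_) z∈))

  sumMove⁻ : ∀ {x y} → Move (SumGame n Gs) x y → ∃₂ λ i z → Move (Gs i) (x i) z × y ≡ x [ i ]≔ z
  sumMove⁻ {x} y∈ with satisfied (∈-concatMap⁻ (λ i → map (x [ i ]≔_) (moves (Gs i) (x i))) {xs = allFin n} y∈)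
  ... | i , y∈ᵢ with ∈-map⁻ (x [ i ]≔_) y∈ᵢ
  ...   | z , z∈ , y≡ = i , z , z∈ , y≡

module ForcedSum (n : ℕ) (Gs : Fin n → Game)
                 (miserable : ∀ i → Miserable (Gs i)) (forced : ∀ i → Forced (Gs i)) where

  open SumMoves n Gs

  private
    S : Game
    S = SumGame n Gs

  AllBalanced : SumPos n Gs → Set
  AllBalanced x = ∀ j → Balanced (Gs j) (x j)

  Unbalanced : SumPos n Gs → Set
  Unbalanced x = ∃ λ j → ¬ Balanced (Gs j) (x j)

  allBalanced⊎unbalanced : ∀ x → AllBalanced x ⊎ Unbalanced x
  allBalanced⊎unbalanced x with all? (λ j → balanced? (Gs j) (x j))
  ... | yes all = inj₁ all
  ... | no ¬all = inj₂ (¬∀⟶∃¬ n _ (λ j → balanced? (Gs j) (x j)) ¬all)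

  sumClass : SumPos n Gs → Bool
  sumClass x = parity λ j → class (Gs j) (x j)

  update-allBalanced : ∀ {x} i {z} → (∀ j → i ≢ j → Balanced (Gs j) (x j)) → Balanced (Gs i) z →
                       AllBalanced (x [ i ]≔ z)
  update-allBalanced {x} i {z} others z-bal j with i ≟ᶠ j
  ... | yes refl = z-bal
  ... | no i≢j   = others j i≢j

  sumClass-flip : ∀ {x x'} i → class (Gs i) (x' i) ≡ not (class (Gs i) (x i)) →
                  (∀ j → i ≢ j → x' j ≡ x j) → sumClass x' ≡ not (sumClass x)
  sumClass-flip i flipped same = parity-flip _ _ i flipped λ j i≢j → cong (class (Gs j)) (same j i≢j)

  allBalanced-move : ∀ {x y} → AllBalanced x → Move S x y → AllBalanced y × sumClass y ≡ not (sumClass x)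
  allBalanced-move {x} bal y∈ with sumMove⁻ y∈
  ... | i , z , z∈ , refl =
      update-allBalanced i (λ j _ → bal j) (Vᵇ⇒balanced z∈V)
    , sumClass-flip i (trans (cong (class (Gs i)) ([]≔-same x i z)) (Vᵇ⇒class≡ z∈V))
                      ([]≔-other x i z)
    where
    z∈V : Vᵇ (Gs i) (not (class (Gs i) (x i))) z
    z∈V = Vᵇ-forced (forced i) z∈ (balanced⇒Vᵇ-class (bal i))

  allBalanced⇒Vᵇ : ∀ x → AllBalanced x → Vᵇ S (sumClass x) x
  allBalanced⇒Vᵇ = game-ind S _ λ x ih bal →
    Vᵇ-by-options (sumClass x)
      (λ y∈ → let bal-y , class-y = allBalanced-move bal y∈ in
              subst (λ b → Vᵇ S b _) class-y (ih y∈ bal-y))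
      (λ odd → let i , class≡true = parity≡true⇒∃ _ odd
                   z , z∈ = V₁₀⇒movable (Gs i) (out₁₀
                              (subst (λ b → Vᵇ (Gs i) b (x i)) class≡true (balanced⇒Vᵇ-class (bal i))))
               in x [ i ]≔ z , sumMove⁺ i z∈)

  sumClass-update : ∀ x i {z z'} → class (Gs i) z' ≡ not (class (Gs i) z) →
                    sumClass (x [ i ]≔ z') ≡ not (sumClass (x [ i ]≔ z))
  sumClass-update x i {z} {z'} flipped = sumClass-flip i
    (begin
      class (Gs i) ((x [ i ]≔ z') i)       ≡⟨ cong (class (Gs i)) ([]≔-same x i z') ⟩
      class (Gs i) z'                      ≡⟨ flipped ⟩
      not (class (Gs i) z)                 ≡⟨ cong (not ∘ class (Gs i)) ([]≔-same x i z) ⟨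
      not (class (Gs i) ((x [ i ]≔ z) i))  ∎)
    (λ j i≢j → trans ([]≔-other x i z' j i≢j) (sym ([]≔-other x i z j i≢j)))

  movableToBoth : ∀ {x} i → (∀ j → i ≢ j → Balanced (Gs j) (x j)) →
                  (∀ c → MovableTo (Gs i) (x i) (Vᵇ (Gs i) c)) → ∀ b → MovableTo S x (Vᵇ S b)
  movableToBoth {x} i others toComponent with toComponent false | toComponent true
  ... | z₀ , z₀∈ , z₀∈V | z₁ , z₁∈ , z₁∈V =
    not-cover (sumClass (x [ i ]≔ z₀)) (_ , sumMove⁺ i z₀∈ , lift z₀∈V)
      (_ , sumMove⁺ i z₁∈ , subst (λ b → Vᵇ S b _) class₁ (lift z₁∈V))
    where
    lift : ∀ {c z} → Vᵇ (Gs i) c z → Vᵇ S (sumClass (x [ i ]≔ z)) (x [ i ]≔ z)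
    lift z∈V = allBalanced⇒Vᵇ _ (update-allBalanced i others (Vᵇ⇒balanced z∈V))
    class₁ : sumClass (x [ i ]≔ z₁) ≡ not (sumClass (x [ i ]≔ z₀))
    class₁ = sumClass-update x i (trans (Vᵇ⇒class≡ z₁∈V) (cong not (sym (Vᵇ⇒class≡ z₀∈V))))

  unbalanced⇒movableToBoth : ∀ {x y} → Unbalanced x → Move S x y → AllBalanced y →
                             ∀ b → MovableTo S x (Vᵇ S b)
  unbalanced⇒movableToBoth {x} (j , ¬bal) y∈ bal-y with sumMove⁻ y∈
  ... | i , z , z∈ , refl with i ≟ᶠ j
  ... | no i≢j = contradiction (subst (Balanced (Gs j)) ([]≔-other x i z j i≢j) (bal-y j)) ¬bal
  ... | yes refl with miserable i (x i)
  ...   | inj₁ bal = contradiction bal ¬bal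
  ...   | inj₂ (inj₁ ¬movable) =
          contradiction (z , z∈ , subst (Balanced (Gs i)) ([]≔-same x i z) (bal-y i)) ¬movable
  ...   | inj₂ (inj₂ (to₀₁ , to₁₀)) =
          movableToBoth i others λ { false → map₂ (map₂ in₀₁) to₀₁ ; true → map₂ (map₂ in₁₀) to₁₀ }
    where
    others : ∀ k → i ≢ k → Balanced (Gs k) (x k)
    others k i≢k = subst (Balanced (Gs k)) ([]≔-other x i z k i≢k) (bal-y k)

  unbalanced⇒movable : ∀ {x} → Unbalanced x → ∃ (Move S x)
  unbalanced⇒movable {x} (j , ¬bal) with V₀₁⊎movable (Gs j) (x j)
  ... | inj₁ v        = contradiction (inj₁ v) ¬bal
  ... | inj₂ (z , z∈) = x [ j ]≔ z , sumMove⁺ j z∈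

  unbalanced⇒grundy≡grundy⁻ : ∀ x → Unbalanced x → grundy S x ≡ grundy⁻ S x
  unbalanced⇒grundy≡grundy⁻ = game-ind S _ λ x ih unbal →
    grundy≡grundy⁻ S (unbalanced⇒movable unbal) λ {y} y∈ → partner unbal y∈ (ih y∈)
    where
    partner : ∀ {x y} → Unbalanced x → Move S x y → (Unbalanced y → grundy S y ≡ grundy⁻ S y) →
              ∃[ y' ] Move S x y' × grundy S y ≡ grundy⁻ S y' × grundy⁻ S y ≡ grundy S y'
    partner {y = y} unbal y∈ ih with allBalanced⊎unbalanced y
    ... | inj₂ unbal-y = y , y∈ , ih unbal-y , sym (ih unbal-y)
    ... | inj₁ bal-y with unbalanced⇒movableToBoth unbal y∈ bal-y (not (sumClass y))
    ...   | y' , y'∈ , y'∈V = y' , y'∈ , Vᵇ-swap (allBalanced⇒Vᵇ y bal-y) y'∈V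

  Vᵇ-forced-sum : ∀ {b x y} → Vᵇ S b x → Move S x y → Vᵇ S (not b) y
  Vᵇ-forced-sum {x = x} {y} x∈V y∈ with allBalanced⊎unbalanced x
  ... | inj₂ unbal = contradiction (unbalanced⇒grundy≡grundy⁻ x unbal) (Vᵇ⇒grundy≢grundy⁻ x∈V)
  ... | inj₁ bal =
    let bal-y , class-y = allBalanced-move bal y∈
        class-x = Vᵇ-unique (allBalanced⇒Vᵇ x bal) x∈V
    in subst (λ c → Vᵇ S c y) (trans class-y (cong not class-x)) (allBalanced⇒Vᵇ y bal-y)

proposition5p6 : (n : ℕ) → 2 ≤ n → (Gs : Fin n → Game) →
    (∀ i → Miserable (Gs i)) → (∀ i → Forced (Gs i)) →
    Forced (SumGame n Gs)
proposition5p6 n _ Gs miserable forced x y y∈ =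
  (λ x∈V₀₁ → out₁₀ (Vᵇ-forced-sum (in₀₁ x∈V₀₁) y∈)) , (λ x∈V₁₀ → out₀₁ (Vᵇ-forced-sum (in₁₀ x∈V₁₀) y∈))
  where open ForcedSum n Gs miserable forced
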